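{- Let $\mathbb{F}$ be a field of positive characteristic $p$ and $S=\{R_0,\dots,R_d\}$ an association scheme on a finite set $X$. Let $0\ne v=\sum_{i=0}^d c_i\overline{A_i}\in\mathbb{F}S$ with $\overline{A_j}v=\overline{k_j}v$ for all $0\le j\le d$. Then: (i) if $R_0\notin U(v)$, then $R_u\notin U(v)$ for every $0\le u\le d$ with $p\nmid k_u$; (ii) if $R_0\in U(v)$, then $R_u\in U(v)$ and $c_u=c_0$ for every $0\le u\le d$ with $p\nmid k_u$; (iii) if $p\nmid k_i$ for all $0\le i\le d$ (i.e. $S$ is $p'$-valenced), then $S$ is $p$-transitive.
   Context: $S$ is an association scheme on $X$ with relations $R_0$ (diagonal), $R_1,\dots,R_d$, intersection numbers $p_{ij}^k$ and valencies $k_i$ (the number of $y$ with $(x,y)\in R_i$, for any fixed $x$). $A_i$ is the $(0,1)$ adjacency matrix of $R_i$, $\overline{A_i}$ its image in $M_X(\mathbb{F})$, $\mathbb{F}S=\mathrm{span}_{\mathbb{F}}\{\overline{A_0},\dots,\overline{A_d}\}$ (an algebra with this basis), $\overline{k_i}$ the image of $k_i$ in $\mathbb{F}$. For $v=\sum_i c_i\overline{A_i}$, $U(v)=\{R_i: c_i\ne0\}$. A trivial submodule of the regular $\mathbb{F}S$-module is $\langle w\rangle_{\mathbb{F}}$ with $0\ne w\in\mathbb{F}S$ and $\overline{A_i}w=\overline{k_i}w$ for all $i$; $S$ is $p$-transitive if there is exactly one such submodule. -}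

module Defs where

open import Level using (Level; _⊔_) renaming (suc to lsuc)
open import Algebra.Bundles using (CommutativeRing)
open import Data.Nat using (ℕ; zero; suc; _<_)
open import Data.Nat.Divisibility using (_∣_)
open import Data.Fin using (Fin; _≟_) renaming (zero to fzero; suc to fsuc)
open import Data.Bool using (Bool; true; false; if_then_else_; _∧_)
open import Data.Product using (_×_; ∃; ∃₂; _,_)
open import Relation.Nullary using (¬_; does)
open import Relation.Binary.PropositionalEquality using (_≡_)

record Field (c ℓ : Level) : Set (lsuc (c ⊔ ℓ)) where
  field
    commutativeRing : CommutativeRing c ℓ
  open CommutativeRing commutativeRing public
  field
    1≉0     : ¬ (1# ≈ 0#)
    inverse : ∀ x → ¬ (x ≈ 0#) → ∃ λ y → x * y ≈ 1#

count : (m : ℕ) → (Fin m → Bool) → ℕ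
count zero    f = 0
count (suc m) f = (if f fzero then 1 else 0) Data.Nat.+ count m (λ z → f (fsuc z))

_==_ : ∀ {m} → Fin m → Fin m → Bool
a == b = does (a ≟ b)

-- An association scheme on X = Fin (suc n) with relations R_0, ..., R_d.
-- rel x y = i  means (x , y) ∈ R_i (the relations partition X × X).
record AssocScheme (n d : ℕ) : Set where
  field
    rel        : Fin (suc n) → Fin (suc n) → Fin (suc d)
    diag→      : ∀ x y → rel x y ≡ fzero → x ≡ y
    diag←      : ∀ x → rel x x ≡ fzero
    nonempty   : ∀ i → ∃₂ λ x y → rel x y ≡ i
    transp     : Fin (suc d) → Fin (suc d)
    transp→    : ∀ i x y → rel x y ≡ i → rel y x ≡ transp i
    transp←    : ∀ i x y → rel y x ≡ transp i → rel x y ≡ i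
    pnum       : Fin (suc d) → Fin (suc d) → Fin (suc d) → ℕ
    pnum-spec  : ∀ i j x y →
                 count (suc n) (λ z → (rel x z == i) ∧ (rel z y == j)) ≡ pnum i j (rel x y)
  -- valency k_i (computed at the point 0 ∈ X; it is independent of the point
  -- by the axioms, being p_{i i'}^0)
  valency : Fin (suc d) → ℕ
  valency i = count (suc n) (λ y → rel fzero y == i)

module _ {c ℓ : Level} (F : Field c ℓ) where
  open Field F
  open import Algebra.Definitions.RawMonoid +-rawMonoid using (sum) renaming (_×_ to _·ℕ_)

  HasCharacteristic : ℕ → Set ℓ
  HasCharacteristic p = (p ·ℕ 1#) ≈ 0# × (∀ m → 0 < m → m < p → ¬ ((m ·ℕ 1#) ≈ 0#))

  Mat : ℕ → Set c
  Mat N = Fin N → Fin N → Carrier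

  _⊗_ : ∀ {N} → Mat N → Mat N → Mat N
  (A ⊗ B) x y = sum (λ z → A x z * B z y)

  _⊙_ : ∀ {N} → Carrier → Mat N → Mat N
  (a ⊙ A) x y = a * A x y

  _≈M_ : ∀ {N} → Mat N → Mat N → Set ℓ
  A ≈M B = ∀ x y → A x y ≈ B x y

  zeroM : ∀ {N} → Mat N
  zeroM x y = 0#

  module _ {n d : ℕ} (S : AssocScheme n d) where
    open AssocScheme S

    Abar : Fin (suc d) → Mat (suc n)
    Abar i x y = if rel x y == i then 1# else 0#

    kbar : Fin (suc d) → Carrier
    kbar i = valency i ·ℕ 1#

    elemFS : (Fin (suc d) → Carrier) → Mat (suc n)
    elemFS cs x y = sum (λ i → cs i * Abar i x y)

    InU : (Fin (suc d) → Carrier) → Fin (suc d) → Set ℓ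
    InU cs i = ¬ (cs i ≈ 0#)

    -- w ∈ FS (coefficients ws) generates a trivial submodule of the regular module
    TrivialGen : (Fin (suc d) → Carrier) → Set ℓ
    TrivialGen ws = ¬ (elemFS ws ≈M zeroM)
                  × (∀ i → (Abar i ⊗ elemFS ws) ≈M (kbar i ⊙ elemFS ws))

    SameSpan : Mat (suc n) → Mat (suc n) → Set (c ⊔ ℓ)
    SameSpan w w' = (∃ λ a → w' ≈M (a ⊙ w)) × (∃ λ b → w ≈M (b ⊙ w'))

    -- exactly one trivial submodule
    PTransitive : Set (c ⊔ ℓ)
    PTransitive = (∃ λ ws → TrivialGen ws)
                × (∀ ws ws' → TrivialGen ws → TrivialGen ws' → SameSpan (elemFS ws) (elemFS ws'))

{-# OPTIONS --safe #-}
-- Write v = Σ c_i A_i and let j' be the transpose of R_j. Comparing the (0,0) entries of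
-- A_j v = k_j v gives k_j c_{j'} = k_j c_0. Double counting the pairs of R_u gives
-- k_{u'} = k_u, so if p ∤ k_u then k_{u'} is invertible in F and c_u = c_0; this is (i) and
-- (ii). For a p'-valenced scheme every trivial generator is therefore a nonzero multiple of
-- the all-ones matrix, which itself generates a trivial submodule.
module Submission where

open import Defs
open import Level using (Level)
open import Data.Nat using (ℕ; suc; _<_)
open import Data.Nat.Divisibility using (_∣_)
open import Data.Fin using (Fin) renaming (zero to fzero)
open import Data.Product using (_×_)
open import Relation.Nullary using (¬_)

import Algebra.Properties.CommutativeMonoid.Sum as CommutativeMonoidSum
import Algebra.Properties.Semiring.Mult as SemiringMult
open import Data.Bool using (Bool; true; false; if_then_else_; _∧_)
open import Data.Bool.Properties using (∧-idem)
open import Data.Fin using (_≟_) renaming (suc to fsuc)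
open import Data.Nat using (zero; NonZero; >-nonZero)
import Data.Nat as ℕ
open import Data.Nat.DivMod using (_%_; _/_; m≡m%n+[m/n]*n; m%n<n)
open import Data.Nat.Divisibility using (m%n≡0⇒n∣m)
open import Data.Nat.Properties using (+-0-commutativeMonoid; *-cancelˡ-≡; n≢0⇒n>0)
open import Data.Product using (_,_; ∃)
open import Function using (_∘_)
open import Relation.Binary.PropositionalEquality
  using (_≡_; _≢_; refl; sym; trans; cong; cong₂; module ≡-Reasoning)
open import Relation.Nullary using (yes; no)
open import Relation.Nullary.Decidable using (dec-true; dec-false)

==-true : ∀ {m} {a b : Fin m} → a ≡ b → (a == b) ≡ true
==-true {a = a} {b} = dec-true (a ≟ b)

==-false : ∀ {m} {a b : Fin m} → a ≢ b → (a == b) ≡ false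
==-false {a = a} {b} = dec-false (a ≟ b)

module ℕΣ = CommutativeMonoidSum +-0-commutativeMonoid

indicator : Bool → ℕ
indicator b = if b then 1 else 0

count≡sum : ∀ m (f : Fin m → Bool) → count m f ≡ ℕΣ.sum (indicator ∘ f)
count≡sum zero    f = refl
count≡sum (suc m) f = cong (indicator (f fzero) ℕ.+_) (count≡sum m (f ∘ fsuc))

count-cong : ∀ m {f g : Fin m → Bool} → (∀ z → f z ≡ g z) → count m f ≡ count m g
count-cong zero    eq = refl
count-cong (suc m) eq = cong₂ ℕ._+_ (cong indicator (eq fzero)) (count-cong m (eq ∘ fsuc))

sum-const : ∀ m k → ℕΣ.sum {m} (λ _ → k) ≡ m ℕ.* k
sum-const zero    k = refl
sum-const (suc m) k = cong (k ℕ.+_) (sum-const m k)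

module SchemeCounting {n d : ℕ} (S : AssocScheme n d) where
  open AssocScheme S

  N : ℕ
  N = suc n

  rel-transp : ∀ u x z → (rel x z == u) ≡ (rel z x == transp u)
  rel-transp u x z with rel x z ≟ u
  ... | yes xz∈u = sym (==-true (transp→ u x z xz∈u))
  ... | no  xz∉u = sym (==-false (xz∉u ∘ transp← u x z))

  transp-involutive : ∀ u → transp (transp u) ≡ u
  transp-involutive u with nonempty u
  ... | x , y , xy∈u = trans (sym (transp→ (transp u) y x (transp→ u x y xy∈u))) xy∈u

  row : Fin N → Fin (suc d) → Fin N → Bool
  row x i z = rel x z == i

  -- Both sides equal p_{i i'}^0, read off at (x , x) and at (0 , 0).
  count-row : ∀ x i → count N (row x i) ≡ valency i
  count-row x i = trans (count-row≡p x) (sym (count-row≡p fzero))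
    where
    count-row≡p : ∀ x → count N (row x i) ≡ pnum i (transp i) fzero
    count-row≡p x = begin
      count N (row x i)
        ≡⟨ count-cong N (λ z → trans (sym (∧-idem (row x i z))) (cong (row x i z ∧_) (rel-transp i x z))) ⟩
      count N (λ z → (rel x z == i) ∧ (rel z x == transp i))
        ≡⟨ pnum-spec i (transp i) x x ⟩
      pnum i (transp i) (rel x x)
        ≡⟨ cong (pnum i (transp i)) (diag← x) ⟩
      pnum i (transp i) fzero ∎
      where open ≡-Reasoning

  relationSize : Fin (suc d) → ℕ
  relationSize u = ℕΣ.sum (λ x → count N (row x u))

  relationSize≡N*valency : ∀ u → relationSize u ≡ N ℕ.* valency u
  relationSize≡N*valency u = trans (ℕΣ.sum-cong-≗ (λ x → count-row x u)) (sum-const N (valency u))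

  relationSize-transp : ∀ u → relationSize u ≡ relationSize (transp u)
  relationSize-transp u = begin
    ℕΣ.sum (λ x → count N (row x u))
      ≡⟨ ℕΣ.sum-cong-≗ (λ x → count≡sum N (row x u)) ⟩
    ℕΣ.sum (λ x → ℕΣ.sum (λ z → indicator (rel x z == u)))
      ≡⟨ ℕΣ.∑-comm (λ x z → indicator (rel x z == u)) ⟩
    ℕΣ.sum (λ z → ℕΣ.sum (λ x → indicator (rel x z == u)))
      ≡⟨ ℕΣ.sum-cong-≗ (λ z → ℕΣ.sum-cong-≗ (λ x → cong indicator (rel-transp u x z))) ⟩
    ℕΣ.sum (λ z → ℕΣ.sum (λ x → indicator (rel z x == transp u)))
      ≡⟨ sym (ℕΣ.sum-cong-≗ (λ z → count≡sum N (row z (transp u)))) ⟩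
    ℕΣ.sum (λ z → count N (row z (transp u))) ∎
    where open ≡-Reasoning

  valency-transp : ∀ u → valency (transp u) ≡ valency u
  valency-transp u = *-cancelˡ-≡ _ _ N (begin
    N ℕ.* valency (transp u) ≡⟨ sym (relationSize≡N*valency (transp u)) ⟩
    relationSize (transp u)  ≡⟨ sym (relationSize-transp u) ⟩
    relationSize u           ≡⟨ relationSize≡N*valency u ⟩
    N ℕ.* valency u          ∎)
    where open ≡-Reasoning

module FieldProperties {c ℓ : Level} (F : Field c ℓ) where
  open Field F renaming (refl to ≈-refl; sym to ≈-sym; trans to ≈-trans)
  open CommutativeMonoidSum +-commutativeMonoid using (sum; sum-cong-≋; sum-replicate-zero)
  open SemiringMult semiring using (×-congʳ; ×-assoc-*; ×-homo-+; ×1-homo-*) renaming (_×_ to _·ℕ_)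
  open import Relation.Binary.Reasoning.Setoid setoid

  *-cancelˡ : ∀ {a x y} → ¬ (a ≈ 0#) → a * x ≈ a * y → x ≈ y
  *-cancelˡ {a} {x} {y} a≉0 ax≈ay with inverse a a≉0
  ... | b , ab≈1 = begin
    x             ≈⟨ ≈-sym (*-identityˡ x) ⟩
    1# * x        ≈⟨ *-congʳ (≈-trans (≈-sym ab≈1) (*-comm a b)) ⟩
    (b * a) * x   ≈⟨ *-assoc b a x ⟩
    b * (a * x)   ≈⟨ *-congˡ ax≈ay ⟩
    b * (a * y)   ≈⟨ ≈-sym (*-assoc b a y) ⟩
    (b * a) * y   ≈⟨ *-congʳ (≈-trans (*-comm b a) ab≈1) ⟩
    1# * y        ≈⟨ *-identityˡ y ⟩
    y             ∎

  ×1-* : ∀ m a → (m ·ℕ 1#) * a ≈ m ·ℕ a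
  ×1-* m a = ≈-trans (×-assoc-* m 1# a) (×-congʳ m (*-identityˡ a))

  ×1≈%×1 : ∀ p .{{_ : NonZero p}} → (p ·ℕ 1#) ≈ 0# → ∀ k → k ·ℕ 1# ≈ (k % p) ·ℕ 1#
  ×1≈%×1 p p·1≈0 k = begin
    k ·ℕ 1#                                      ≡⟨ cong (_·ℕ 1#) (m≡m%n+[m/n]*n k p) ⟩
    (k % p ℕ.+ (k / p) ℕ.* p) ·ℕ 1#              ≈⟨ ×-homo-+ 1# (k % p) ((k / p) ℕ.* p) ⟩
    (k % p) ·ℕ 1# + ((k / p) ℕ.* p) ·ℕ 1#        ≈⟨ +-congˡ (×1-homo-* (k / p) p) ⟩
    (k % p) ·ℕ 1# + ((k / p) ·ℕ 1#) * (p ·ℕ 1#) ≈⟨ +-congˡ (≈-trans (*-congˡ p·1≈0) (zeroʳ _)) ⟩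
    (k % p) ·ℕ 1# + 0#                           ≈⟨ +-identityʳ _ ⟩
    (k % p) ·ℕ 1#                                ∎

  ×1≉0 : ∀ p → 0 < p → HasCharacteristic F p → ∀ k → ¬ (p ∣ k) → ¬ (k ·ℕ 1# ≈ 0#)
  ×1≉0 p p>0 (p·1≈0 , p-minimal) k p∤k k·1≈0 =
    p-minimal (k % p) k%p>0 (m%n<n k p) (≈-trans (≈-sym (×1≈%×1 p p·1≈0 k)) k·1≈0)
    where
    instance
      p≢0 : NonZero p
      p≢0 = >-nonZero p>0
    k%p>0 : 0 < k % p
    k%p>0 = n≢0⇒n>0 (p∤k ∘ m%n≡0⇒n∣m k p)

  sum-if : ∀ m (b : Fin m → Bool) a → sum (λ z → if b z then a else 0#) ≈ count m b ·ℕ a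
  sum-if zero    b a = ≈-refl
  sum-if (suc m) b a with b fzero
  ... | true  = +-congˡ (sum-if m (b ∘ fsuc) a)
  ... | false = ≈-trans (+-identityˡ _) (sum-if m (b ∘ fsuc) a)

  sum-*-indicator : ∀ m (g : Fin m → Carrier) k → sum (λ i → g i * (if k == i then 1# else 0#)) ≈ g k
  sum-*-indicator (suc m) g fzero = begin
    g fzero * 1# + sum (λ i → g (fsuc i) * 0#) ≈⟨ +-cong (*-identityʳ _) (sum-cong-≋ (λ i → zeroʳ (g (fsuc i)))) ⟩
    g fzero + sum {m} (λ _ → 0#)               ≈⟨ +-congˡ (sum-replicate-zero m) ⟩
    g fzero + 0#                               ≈⟨ +-identityʳ _ ⟩
    g fzero                                    ∎
  sum-*-indicator (suc m) g (fsuc k) =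
    ≈-trans (+-cong (zeroʳ _) (sum-*-indicator m (g ∘ fsuc) k)) (+-identityˡ _)

module SchemeAlgebra {c ℓ : Level} (F : Field c ℓ) {n d : ℕ} (S : AssocScheme n d) where
  open Field F hiding (refl) renaming (sym to ≈-sym; trans to ≈-trans)
  open CommutativeMonoidSum +-commutativeMonoid using (sum; sum-cong-≋)
  open SemiringMult semiring using () renaming (_×_ to _·ℕ_)
  open FieldProperties F
  open AssocScheme S
  open SchemeCounting S
  open import Relation.Binary.Reasoning.Setoid setoid

  Coefficients : Set c
  Coefficients = Fin (suc d) → Carrier

  ActsTrivially : Coefficients → Set ℓ
  ActsTrivially cs = ∀ j → _≈M_ F (_⊗_ F (Abar F S j) (elemFS F S cs)) (_⊙_ F (kbar F S j) (elemFS F S cs))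

  elemFS-entry : ∀ cs x y → elemFS F S cs x y ≈ cs (rel x y)
  elemFS-entry cs x y = sum-*-indicator (suc d) cs (rel x y)

  Abar-⊗-entry : ∀ cs j x y a → (∀ z → rel x z ≡ j → elemFS F S cs z y ≈ a) →
                 _⊗_ F (Abar F S j) (elemFS F S cs) x y ≈ kbar F S j * a
  Abar-⊗-entry cs j x y a on-row = begin
    sum (λ z → Abar F S j x z * elemFS F S cs z y) ≈⟨ sum-cong-≋ pointwise ⟩
    sum (λ z → if row x j z then a else 0#)        ≈⟨ sum-if N (row x j) a ⟩
    count N (row x j) ·ℕ a                          ≡⟨ cong (_·ℕ a) (count-row x j) ⟩
    valency j ·ℕ a                                  ≈⟨ ≈-sym (×1-* (valency j) a) ⟩
    kbar F S j * a                                  ∎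
    where
    pointwise : ∀ z → Abar F S j x z * elemFS F S cs z y ≈ (if row x j z then a else 0#)
    pointwise z with rel x z ≟ j
    ... | yes xz∈j = ≈-trans (*-identityˡ _) (on-row z xz∈j)
    ... | no  _    = zeroˡ _

  kbar-*-transp : ∀ cs → ActsTrivially cs → ∀ j → kbar F S j * cs (transp j) ≈ kbar F S j * cs fzero
  kbar-*-transp cs trivial j = begin
    kbar F S j * cs (transp j)                      ≈⟨ ≈-sym (Abar-⊗-entry cs j fzero fzero _ on-row) ⟩
    _⊗_ F (Abar F S j) (elemFS F S cs) fzero fzero ≈⟨ trivial j fzero fzero ⟩
    kbar F S j * elemFS F S cs fzero fzero          ≈⟨ *-congˡ (elemFS-entry cs fzero fzero) ⟩
    kbar F S j * cs (rel fzero fzero)               ≡⟨ cong (λ i → kbar F S j * cs i) (diag← fzero) ⟩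
    kbar F S j * cs fzero                           ∎
    where
    on-row : ∀ z → rel fzero z ≡ j → elemFS F S cs z fzero ≈ cs (transp j)
    on-row z 0z∈j = ≈-trans (elemFS-entry cs z fzero) (reflexive (cong cs (transp→ j fzero z 0z∈j)))

  allOnes : Coefficients
  allOnes _ = 1#

  allOnes-trivialGen : TrivialGen F S allOnes
  allOnes-trivialGen = nonzero , trivial
    where
    nonzero : ¬ _≈M_ F (elemFS F S allOnes) (zeroM F)
    nonzero J≈0 = 1≉0 (≈-trans (≈-sym (elemFS-entry allOnes fzero fzero)) (J≈0 fzero fzero))
    trivial : ActsTrivially allOnes
    trivial i x y = begin
      _⊗_ F (Abar F S i) (elemFS F S allOnes) x y ≈⟨ Abar-⊗-entry allOnes i x y 1# (λ z _ → elemFS-entry allOnes z y) ⟩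
      kbar F S i * 1#                             ≈⟨ *-congˡ (≈-sym (elemFS-entry allOnes x y)) ⟩
      kbar F S i * elemFS F S allOnes x y         ∎

  module WithCharacteristic (p : ℕ) (p>0 : 0 < p) (char-p : HasCharacteristic F p) where

    kbar-transp≉0 : ∀ u → ¬ (p ∣ valency u) → ¬ (kbar F S (transp u) ≈ 0#)
    kbar-transp≉0 u p∤ku rewrite valency-transp u = ×1≉0 p p>0 char-p (valency u) p∤ku

    coefficient≈coefficient₀ : ∀ cs → ActsTrivially cs → ∀ u → ¬ (p ∣ valency u) → cs u ≈ cs fzero
    coefficient≈coefficient₀ cs trivial u p∤ku = *-cancelˡ (kbar-transp≉0 u p∤ku) (begin
      kbar F S (transp u) * cs u                   ≡⟨ cong (λ i → kbar F S (transp u) * cs i) (sym (transp-involutive u)) ⟩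
      kbar F S (transp u) * cs (transp (transp u)) ≈⟨ kbar-*-transp cs trivial (transp u) ⟩
      kbar F S (transp u) * cs fzero               ∎)

    R₀∉U⇒Rᵤ∉U : ∀ cs → ActsTrivially cs → ¬ InU F S cs fzero →
                ∀ u → ¬ (p ∣ valency u) → ¬ InU F S cs u
    R₀∉U⇒Rᵤ∉U cs trivial R₀∉U u p∤ku Rᵤ∈U =
      R₀∉U (λ c₀≈0 → Rᵤ∈U (≈-trans (coefficient≈coefficient₀ cs trivial u p∤ku) c₀≈0))

    R₀∈U⇒Rᵤ∈U : ∀ cs → ActsTrivially cs → InU F S cs fzero →
                ∀ u → ¬ (p ∣ valency u) → InU F S cs u × cs u ≈ cs fzero
    R₀∈U⇒Rᵤ∈U cs trivial R₀∈U u p∤ku =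
        (λ cu≈0 → R₀∈U (≈-trans (≈-sym cu≈c₀) cu≈0))
      , cu≈c₀
      where
      cu≈c₀ : cs u ≈ cs fzero
      cu≈c₀ = coefficient≈coefficient₀ cs trivial u p∤ku

    module _ (p∤valencies : ∀ i → ¬ (p ∣ valency i)) where

      elemFS-constant : ∀ cs → ActsTrivially cs → ∀ x y → elemFS F S cs x y ≈ cs fzero
      elemFS-constant cs trivial x y =
        ≈-trans (elemFS-entry cs x y) (coefficient≈coefficient₀ cs trivial (rel x y) (p∤valencies _))

      trivialGen-coefficient₀≉0 : ∀ ws → TrivialGen F S ws → ¬ (ws fzero ≈ 0#)
      trivialGen-coefficient₀≉0 ws (ws≉0 , trivial) ws₀≈0 =
        ws≉0 (λ x y → ≈-trans (elemFS-constant ws trivial x y) ws₀≈0)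

      trivialGen-multiple : ∀ ws ws' → TrivialGen F S ws → TrivialGen F S ws' →
                            ∃ λ a → _≈M_ F (elemFS F S ws') (_⊙_ F a (elemFS F S ws))
      trivialGen-multiple ws ws' gen@(_ , trivial) (_ , trivial') with inverse (ws fzero) (trivialGen-coefficient₀≉0 ws gen)
      ... | b , ws₀b≈1 = ws' fzero * b , λ x y → begin
        elemFS F S ws' x y                  ≈⟨ elemFS-constant ws' trivial' x y ⟩
        ws' fzero                           ≈⟨ ≈-sym (*-identityʳ _) ⟩
        ws' fzero * 1#                      ≈⟨ *-congˡ (≈-sym (≈-trans (*-comm b (ws fzero)) ws₀b≈1)) ⟩
        ws' fzero * (b * ws fzero)          ≈⟨ ≈-sym (*-assoc _ _ _) ⟩
        (ws' fzero * b) * ws fzero          ≈⟨ *-congˡ (≈-sym (elemFS-constant ws trivial x y)) ⟩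
        (ws' fzero * b) * elemFS F S ws x y ∎
      p'-valenced⇒p-transitive : PTransitive F S
      p'-valenced⇒p-transitive =
          (allOnes , allOnes-trivialGen)
        , λ ws ws' gen gen' → trivialGen-multiple ws ws' gen gen' , trivialGen-multiple ws' ws gen' gen

lemma2p7 : ∀ {c ℓ : Level} (F : Field c ℓ) (p : ℕ) → 0 < p → HasCharacteristic F p →
           ∀ (n d : ℕ) (S : AssocScheme n d) →
           (∀ (cs : Fin (suc d) → Field.Carrier F) →
             ¬ (_≈M_ F (elemFS F S cs) (zeroM F)) →
             (∀ j → _≈M_ F (_⊗_ F (Abar F S j) (elemFS F S cs)) (_⊙_ F (kbar F S j) (elemFS F S cs))) →
             ((¬ InU F S cs fzero → ∀ u → ¬ (p ∣ AssocScheme.valency S u) → ¬ InU F S cs u)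
             × (InU F S cs fzero → ∀ u → ¬ (p ∣ AssocScheme.valency S u) →
                  InU F S cs u × Field._≈_ F (cs u) (cs fzero))))
           × ((∀ i → ¬ (p ∣ AssocScheme.valency S i)) → PTransitive F S)
lemma2p7 F p p>0 char-p n d S =
    (λ cs _ trivial → R₀∉U⇒Rᵤ∉U cs trivial , R₀∈U⇒Rᵤ∈U cs trivial)
  , p'-valenced⇒p-transitive
  where
  open SchemeAlgebra F S
  open WithCharacteristic p p>0 char-p
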